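{- Let $G$ be a finite simple connected graph with minimum degree $\delta(G)\geq 3$. If $Z(G)=3$, then the edge connectivity of $G$ satisfies $\kappa'(G)\geq 3$.
   Context: Zero forcing: each vertex of $G$ is coloured black or white. Colour-change rule: if a black vertex $u$ has exactly one white neighbour $v$, then $v$ is recoloured black. A set $Z\subseteq V(G)$ is a zero forcing set if, starting with exactly the vertices of $Z$ black and applying the colour-change rule until no further change is possible, all vertices become black. The zero forcing number $Z(G)$ is the minimum size of a zero forcing set. $\kappa'(G)$ is the edge connectivity of $G$ (minimum number of edges whose removal disconnects $G$). -}

module Defs where

open import Data.Nat using (ℕ; _≤_; _<_)
open import Data.Bool using (Bool; true; false)
open import Data.Fin using (Fin)
open import Data.Fin.Subset using (Subset; _∈_; ∣_∣)
open import Data.Vec using (tabulate)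
open import Data.List using (List; length)
open import Data.Product using (_×_; Σ-syntax; _,_)
import Data.List.Membership.Propositional as LM
open import Relation.Binary.PropositionalEquality using (_≡_; _≢_)
open import Relation.Binary.Construct.Closure.ReflexiveTransitive using (Star)
open import Relation.Nullary using (¬_)

record Graph (n : ℕ) : Set where
  field
    adj     : Fin n → Fin n → Bool
    adj-sym : ∀ u v → adj u v ≡ adj v u
    loopless : ∀ u → adj u u ≡ false

open Graph public

Adj : ∀ {n} → Graph n → Fin n → Fin n → Set
Adj G u v = adj G u v ≡ true

N : ∀ {n} → Graph n → Fin n → Subset n
N G u = tabulate (adj G u)

degree : ∀ {n} → Graph n → Fin n → ℕ
degree G u = ∣ N G u ∣

MinDegreeAtLeast : ∀ {n} → ℕ → Graph n → Set
MinDegreeAtLeast k G = ∀ u → k ≤ degree G u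

ConnectedRel : ∀ {n} → (Fin n → Fin n → Set) → Set
ConnectedRel {n} R = ∀ (u v : Fin n) → Star R u v

Connected : ∀ {n} → Graph n → Set
Connected G = ConnectedRel (Adj G)

AdjMinus : ∀ {n} → Graph n → List (Fin n × Fin n) → Fin n → Fin n → Set
AdjMinus G F u v = Adj G u v × ¬ ((u , v) LM.∈ F) × ¬ ((v , u) LM.∈ F)

EdgeConnectivityAtLeast : ∀ {n} → ℕ → Graph n → Set
EdgeConnectivityAtLeast k G =
  ∀ F → length F < k → ConnectedRel (AdjMinus G F)

-- Zero forcing closure: Forced G Z v means v becomes black when starting with
-- exactly Z black and applying the colour-change rule repeatedly.
-- (Least set containing Z closed under the rule: if u is black and every
-- neighbour of u other than v is black, then v becomes black.)
data Forced {n} (G : Graph n) (Z : Subset n) : Fin n → Set where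
  initial : ∀ {v} → v ∈ Z → Forced G Z v
  force   : ∀ {u v} → Forced G Z u → Adj G u v →
            (∀ w → Adj G u w → w ≢ v → Forced G Z w) →
            Forced G Z v

IsZeroForcingSet : ∀ {n} → Graph n → Subset n → Set
IsZeroForcingSet G Z = ∀ v → Forced G Z v

ZeroForcingNumber≡ : ∀ {n} → Graph n → ℕ → Set
ZeroForcingNumber≡ {n} G k =
  (Σ[ Z ∈ Subset n ] (IsZeroForcingSet G Z × ∣ Z ∣ ≡ k))
  × (∀ (Z : Subset n) → IsZeroForcingSet G Z → k ≤ ∣ Z ∣)

module Submission where

-- Suppose a set F of at most two edges separates G − F into two sides, and run zero
-- forcing from three vertices, keeping track of the three ends of the forcing chains.
-- For a side X the potential (chain ends in X) + (edges of F with both ends black) never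
-- decreases: a chain end leaves X only by forcing across F, which blackens an edge of F.
-- Each side X reaches potential 3 at a time when all chain ends lie in X or at most one
-- edge of F is black; this is seen at the first force by a vertex of X, whose at least
-- three neighbours are its white target, chain ends in X, or ends of black edges of F.
-- At the later of these two times both potentials are at least 3, while there are three
-- chain ends and at most two black edges of F.

open import Defs
open import Data.Nat using (ℕ; zero; suc; _+_; _≤_; _<_; z≤n; s≤s; _≤′_; ≤′-refl; ≤′-step)
open import Data.Nat.Properties
open import Algebra.Properties.CommutativeSemigroup +-commutativeSemigroup using (x∙yz≈y∙xz)
open import Data.Bool using (Bool; true; false; not; _∨_; if_then_else_)
import Data.Bool.Properties as Bool
open import Data.Fin using (Fin; zero; suc; toℕ)
import Data.Fin.Properties as Fin
open import Data.Fin.Subset using (Subset; ⁅_⁆; _∪_; ⋃; ∣_∣) renaming (_∈_ to _∈ₛ_)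
import Data.Fin.Subset.Properties as Subset
open import Data.Vec using (tabulate; _∷_)
import Data.Vec as Vec
open import Data.Vec.Properties using (lookup∘tabulate; []=⇒lookup)
open import Data.List using (List; []; _∷_; length; _++_; map; filter)
open import Data.List.Properties
  using (length-++; length-map; length-filter; filter-++; filter-accept; filter-notAll)
open import Data.List.Membership.Propositional using (_∈_; _∉_)
import Data.List.Membership.DecPropositional as DecMembership
open import Data.List.Membership.Propositional.Properties
  using (∈-++⁺ˡ; ∈-++⁺ʳ; ∈-++⁻; ∈-insert; ∈-∃++; ∈-filter⁺; ∈-filter⁻; ∈-map⁺; ∈-map⁻)
open import Data.List.Relation.Unary.Any using (Any; here; there)
import Data.List.Relation.Unary.Any as Any
open import Data.Product using (_×_; _,_; proj₁; proj₂; ∃)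
open import Data.Sum using (_⊎_; inj₁; inj₂; [_,_]′)
open import Data.Empty using (⊥; ⊥-elim)
open import Function using (_∘_)
open import Relation.Binary.PropositionalEquality
open import Relation.Binary.Construct.Closure.ReflexiveTransitive using (Star; ε; _◅_; _◅◅_)
import Data.Product.Properties as Product
open import Relation.Nullary using (¬_; Dec; yes; no; does; contradiction)
open import Relation.Nullary.Decidable using (_×-dec_; _⊎-dec_; _→-dec_; ¬?; decidable-stable; dec-true; dec-yes)
open import Relation.Unary using (Pred; Decidable)

private variable
  n : ℕ

module _ {p} {P : Pred ℕ p} (P? : Decidable P) where

  least-below : ∀ k → (∃ λ m → m < k × P m × (∀ {t} → t < m → ¬ P t)) ⊎ (∀ {t} → t < k → ¬ P t)
  least-below zero = inj₂ λ ()
  least-below (suc k) with least-below k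
  ... | inj₁ (m , m<k , pm , below) = inj₁ (m , m≤n⇒m≤1+n m<k , pm , below)
  ... | inj₂ none with P? k
  ...   | yes pk = inj₁ (k , ≤-refl , pk , none)
  ...   | no ¬pk = inj₂ λ t<1+k → [ none , (λ { refl → ¬pk }) ]′ (m≤n⇒m<n∨m≡n (≤-pred t<1+k))

  crossing : ∀ {a b} → a ≤ b → ¬ P a → P b → ∃ λ l → a ≤ l × l < b × ¬ P l × P (suc l)
  crossing {a} {zero} z≤n ¬pa pb = contradiction pb ¬pa
  crossing {a} {suc b} a≤1+b ¬pa p1+b with m≤n⇒m<n∨m≡n a≤1+b
  ... | inj₂ refl = contradiction p1+b ¬pa
  ... | inj₁ a<1+b with P? b
  ...   | no ¬pb = b , ≤-pred a<1+b , ≤-refl , ¬pb , p1+b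
  ...   | yes pb with crossing (≤-pred a<1+b) ¬pa pb
  ...     | l , a≤l , l<b , ¬pl , p1+l = l , a≤l , m≤n⇒m≤1+n l<b , ¬pl , p1+l

module _ {a ℓ} {A : Set a} (_≼_ : A → A → Set ℓ)
         (≼-refl : ∀ {x} → x ≼ x) (≼-trans : ∀ {x y z} → x ≼ y → y ≼ z → x ≼ z) where

  stepwise-mono : ∀ (f : ℕ → A) {m} → (∀ {t} → t < m → f t ≼ f (suc t)) →
                  ∀ {s t} → s ≤ t → t ≤ m → f s ≼ f t
  stepwise-mono f {m} step {s} s≤t = go (≤⇒≤′ s≤t)
    where
    go : ∀ {t} → s ≤′ t → t ≤ m → f s ≼ f t
    go ≤′-refl        _   = ≼-refl
    go (≤′-step s≤′t) t<m = ≼-trans (go s≤′t (<⇒≤ t<m)) (step t<m)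

module _ {a p q} {A : Set a} {P : Pred A p} {Q : Pred A q} (P? : Decidable P) (Q? : Decidable Q) where

  length-filter-mono : (∀ {x} → P x → Q x) → ∀ xs → length (filter P? xs) ≤ length (filter Q? xs)
  length-filter-mono P⇒Q [] = z≤n
  length-filter-mono P⇒Q (x ∷ xs) with P? x | Q? x
  ... | yes px | yes _  = s≤s (length-filter-mono P⇒Q xs)
  ... | yes px | no ¬qx = contradiction (P⇒Q px) ¬qx
  ... | no _   | yes _  = m≤n⇒m≤1+n (length-filter-mono P⇒Q xs)
  ... | no _   | no _   = length-filter-mono P⇒Q xs

  length-filter-mono-< : (∀ {x} → P x → Q x) → ∀ {xs} → Any (λ x → Q x × ¬ P x) xs →
                         length (filter P? xs) < length (filter Q? xs)
  length-filter-mono-< P⇒Q {x ∷ xs} (here (qx , ¬px)) with P? x | Q? x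
  ... | yes px | _      = contradiction px ¬px
  ... | no _   | yes _  = s≤s (length-filter-mono P⇒Q xs)
  ... | no _   | no ¬qx = contradiction qx ¬qx
  length-filter-mono-< P⇒Q {x ∷ xs} (there any) with P? x | Q? x
  ... | yes px | yes _  = s≤s (length-filter-mono-< P⇒Q any)
  ... | yes px | no ¬qx = contradiction (P⇒Q px) ¬qx
  ... | no _   | yes _  = m≤n⇒m≤1+n (length-filter-mono-< P⇒Q any)
  ... | no _   | no _   = length-filter-mono-< P⇒Q any

  length-filter-disjoint : (∀ {x} → P x → Q x → ⊥) → ∀ xs →
                           length (filter P? xs) + length (filter Q? xs) ≤ length xs
  length-filter-disjoint P∩Q=∅ [] = z≤n
  length-filter-disjoint P∩Q=∅ (x ∷ xs) with P? x | Q? x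
  ... | yes px | yes qx = ⊥-elim (P∩Q=∅ px qx)
  ... | yes _  | no _   = s≤s (length-filter-disjoint P∩Q=∅ xs)
  ... | no _   | yes _  = ≤-trans (≤-reflexive (+-suc _ _)) (s≤s (length-filter-disjoint P∩Q=∅ xs))
  ... | no _   | no _   = m≤n⇒m≤1+n (length-filter-disjoint P∩Q=∅ xs)

module _ {a p} {A : Set a} {P : Pred A p} (P? : Decidable P) where

  length-filter-middle : ∀ xs w ys →
    length (filter P? (xs ++ w ∷ ys)) ≡ length (filter P? (w ∷ [])) + length (filter P? (xs ++ ys))
  length-filter-middle xs w ys = begin
    length (filter P? (xs ++ w ∷ ys))              ≡⟨ cong length (filter-++ P? xs (w ∷ ys)) ⟩
    length (fxs ++ filter P? (w ∷ [] ++ ys))       ≡⟨ length-++ fxs ⟩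
    length fxs + length (filter P? (w ∷ [] ++ ys)) ≡⟨ cong (λ zs → length fxs + length zs) (filter-++ P? (w ∷ []) ys) ⟩
    length fxs + length (fw ++ fys)                ≡⟨ cong (length fxs +_) (length-++ fw) ⟩
    length fxs + (length fw + length fys)          ≡⟨ x∙yz≈y∙xz (length fxs) (length fw) (length fys) ⟩
    length fw + (length fxs + length fys)          ≡⟨ cong (length fw +_) (length-++ fxs) ⟨
    length fw + length (fxs ++ fys)                ≡⟨ cong (λ zs → length fw + length zs) (filter-++ P? xs ys) ⟨
    length fw + length (filter P? (xs ++ ys))      ∎
    where
    open ≡-Reasoning
    fxs = filter P? xs
    fw  = filter P? (w ∷ [])
    fys = filter P? ys

module _ {a} {A : Set a} where

  ∈-++-∷⁻ : ∀ xs {ys} {v w : A} → v ∈ xs ++ w ∷ ys → v ≡ w ⊎ v ∈ xs ++ ys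
  ∈-++-∷⁻ xs v∈ with ∈-++⁻ xs v∈
  ... | inj₁ v∈xs         = inj₂ (∈-++⁺ˡ v∈xs)
  ... | inj₂ (here v≡w)   = inj₁ v≡w
  ... | inj₂ (there v∈ys) = inj₂ (∈-++⁺ʳ xs v∈ys)

  ∈-++-∷⁺ : ∀ xs {ys} {v w : A} → v ∈ xs ++ ys → v ∈ xs ++ w ∷ ys
  ∈-++-∷⁺ xs v∈ with ∈-++⁻ xs v∈
  ... | inj₁ v∈xs = ∈-++⁺ˡ v∈xs
  ... | inj₂ v∈ys = ∈-++⁺ʳ xs (there v∈ys)


∣⁅x⁆∪p∣≤1+∣p∣ : ∀ (x : Fin n) p → ∣ ⁅ x ⁆ ∪ p ∣ ≤ suc ∣ p ∣
∣⁅x⁆∪p∣≤1+∣p∣ zero    (false ∷ p) = ≤-reflexive (cong (suc ∘ ∣_∣) (Subset.∪-identityˡ p))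
∣⁅x⁆∪p∣≤1+∣p∣ zero    (true ∷ p) = s≤s (≤-trans (≤-reflexive (cong ∣_∣ (Subset.∪-identityˡ p))) (n≤1+n _))
∣⁅x⁆∪p∣≤1+∣p∣ (suc x) (false ∷ p) = ∣⁅x⁆∪p∣≤1+∣p∣ x p
∣⁅x⁆∪p∣≤1+∣p∣ (suc x) (true ∷ p) = s≤s (∣⁅x⁆∪p∣≤1+∣p∣ x p)

∣⋃⁅xs⁆∣≤length : ∀ (xs : List (Fin n)) → ∣ ⋃ (map ⁅_⁆ xs) ∣ ≤ length xs
∣⋃⁅xs⁆∣≤length {n} [] = ≤-reflexive (Subset.∣⊥∣≡0 n)
∣⋃⁅xs⁆∣≤length (x ∷ xs) = ≤-trans (∣⁅x⁆∪p∣≤1+∣p∣ x _) (s≤s (∣⋃⁅xs⁆∣≤length xs))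

∈⋃⁅xs⁆ : ∀ {x : Fin n} {xs} → x ∈ xs → x ∈ₛ ⋃ (map ⁅_⁆ xs)
∈⋃⁅xs⁆ (here refl) = Subset.x∈p∪q⁺ (inj₁ (Subset.x∈⁅x⁆ _))
∈⋃⁅xs⁆ (there x∈xs) = Subset.x∈p∪q⁺ (inj₂ (∈⋃⁅xs⁆ x∈xs))

∣p∣≤length : ∀ (p : Subset n) xs → (∀ {x} → x ∈ₛ p → x ∈ xs) → ∣ p ∣ ≤ length xs
∣p∣≤length p xs p⊆xs = ≤-trans (Subset.p⊆q⇒∣p∣≤∣q∣ (∈⋃⁅xs⁆ ∘ p⊆xs)) (∣⋃⁅xs⁆∣≤length xs)

_⊆ᵇ_ : (Fin n → Bool) → (Fin n → Bool) → Set
p ⊆ᵇ q = ∀ x → p x ≡ true → q x ≡ true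

⊆ᵇ-stepwise-mono : ∀ (S : ℕ → Fin n → Bool) {m} → (∀ {t} → t < m → S t ⊆ᵇ S (suc t)) →
                   ∀ {s t} → s ≤ t → t ≤ m → S s ⊆ᵇ S t
⊆ᵇ-stepwise-mono = stepwise-mono _⊆ᵇ_ (λ _ p → p) (λ p⊆q q⊆r x → q⊆r x ∘ p⊆q x)

growing⇒mono : ∀ (S : ℕ → Fin n → Bool) → (∀ t → S t ⊆ᵇ S (suc t)) → ∀ {s t} → s ≤ t → S s ⊆ᵇ S t
growing⇒mono S grows s≤t = ⊆ᵇ-stepwise-mono S (λ {t} _ → grows t) s≤t ≤-refl

module _ {n} (S : ℕ → Fin n → Bool) (grows : ∀ t → S t ⊆ᵇ S (suc t)) where

  private
    Gains : ℕ → Set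
    Gains k = ∃ λ x → S (suc k) x ≡ true × S k x ≡ false

    gains? : ∀ k → Dec (Gains k)
    gains? k = Fin.any? λ x → (S (suc k) x Bool.≟ true) ×-dec (S k x Bool.≟ false)

    no-gain⇒stable : ∀ {k} → ¬ Gains k → S (suc k) ⊆ᵇ S k
    no-gain⇒stable {k} ¬gain x x∈S[1+k] with S k x in x∈?S[k]
    ... | true  = refl
    ... | false = ⊥-elim (¬gain (x , x∈S[1+k] , x∈?S[k]))

    cannot-gain-n+1-times : ¬ (∀ k → k ≤ n → Gains k)
    cannot-gain-n+1-times gain =
      let i , j , i<j , same = Fin.pigeonhole (n<1+n n) (proj₁ ∘ gain-at) in
      Bool.not-¬ (proj₂ (proj₂ (gain-at j)))
        (subst (λ x → S (toℕ j) x ≡ true) same (growing⇒mono S grows i<j _ (proj₁ (proj₂ (gain-at i)))))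
      where
      gain-at : ∀ (i : Fin (suc n)) → Gains (toℕ i)
      gain-at i = gain (toℕ i) (Fin.toℕ≤pred[n] i)

  growing⇒stabilises : ∃ λ k → k ≤ n × S (suc k) ⊆ᵇ S k
  growing⇒stabilises with anyUpTo? (¬? ∘ gains?) (suc n)
  ... | yes (k , k<1+n , ¬gain) = k , ≤-pred k<1+n , no-gain⇒stable ¬gain
  ... | no ¬some = ⊥-elim (cannot-gain-n+1-times λ k k≤n →
                     decidable-stable (gains? k) λ ¬gain → ¬some (k , s≤s k≤n , ¬gain))

elements : Subset n → List (Fin n)
elements Vec.[]        = []
elements (false ∷ p) = map suc (elements p)
elements (true ∷ p)  = zero ∷ map suc (elements p)

length-elements : ∀ (p : Subset n) → length (elements p) ≡ ∣ p ∣
length-elements Vec.[]        = refl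
length-elements (false ∷ p) = trans (length-map suc (elements p)) (length-elements p)
length-elements (true ∷ p)  = cong suc (trans (length-map suc (elements p)) (length-elements p))

∈-elements⁺ : ∀ {x} (p : Subset n) → x ∈ₛ p → x ∈ elements p
∈-elements⁺ (true ∷ p)  Vec.here          = here refl
∈-elements⁺ (true ∷ p)  (Vec.there x∈p) = there (∈-map⁺ suc (∈-elements⁺ p x∈p))
∈-elements⁺ (false ∷ p) (Vec.there x∈p) = ∈-map⁺ suc (∈-elements⁺ p x∈p)

∈-elements⁻ : ∀ {x} (p : Subset n) → x ∈ elements p → x ∈ₛ p
∈-elements⁻ (true ∷ p)  (here refl) = Vec.here
∈-elements⁻ (true ∷ p)  (there x∈) with _ , y∈ , refl ← ∈-map⁻ suc x∈ = Vec.there (∈-elements⁻ p y∈)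
∈-elements⁻ (false ∷ p) x∈ with _ , y∈ , refl ← ∈-map⁻ suc x∈ = Vec.there (∈-elements⁻ p y∈)

∨-≟-inserted : ∀ b (x : Fin n) → (b ∨ does (x Fin.≟ x)) ≡ true
∨-≟-inserted b x rewrite ≡-≟-identity Fin._≟_ (refl {x = x}) = Bool.∨-zeroʳ b

∨-≟⁻ : ∀ b (x g : Fin n) → (b ∨ does (x Fin.≟ g)) ≡ true → b ≡ true ⊎ x ≡ g
∨-≟⁻ true  _ _ _ = inj₁ refl
∨-≟⁻ false x g _ with x Fin.≟ g
... | yes x≡g = inj₂ x≡g

module _ (G : Graph n) where

  Adj-sym : ∀ {x y} → Adj G x y → Adj G y x
  Adj-sym {x} {y} x~y = trans (adj-sym G y x) x~y

  Adj-irrefl : ∀ {x y} → Adj G x y → x ≢ y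
  Adj-irrefl {x} x~x refl = contradiction (trans (sym x~x) (loopless G x)) λ ()

  degree≤length : ∀ x ys → (∀ {y} → Adj G x y → y ∈ ys) → degree G x ≤ length ys
  degree≤length x ys cover = ∣p∣≤length (N G x) ys λ {y} y∈N →
    cover (trans (sym (lookup∘tabulate (adj G x) y)) ([]=⇒lookup y∈N))

-- The list
-- active t holds the current ends of the k forcing chains: the forcer at step t
-- leaves it and the vertex it forces takes its place.
record ForcingRun (G : Graph n) (k : ℕ) : Set where
  field
    duration      : ℕ
    black         : ℕ → Fin n → Bool
    active        : ℕ → List (Fin n)
    forcer forced : ℕ → Fin n
    before after  : ℕ → List (Fin n)
    active-length : ∀ t → length (active t) ≡ k
    black₀⇒active : ∀ {x} → black 0 x ≡ true → x ∈ active 0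
    active₀⇒black : ∀ {x} → x ∈ active 0 → black 0 x ≡ true
    active-split  : ∀ {t} → t < duration → active t ≡ before t ++ forcer t ∷ after t
    active-step   : ∀ {t} → t < duration → active (suc t) ≡ before t ++ forced t ∷ after t
    forced-white  : ∀ {t} → t < duration → black t (forced t) ≡ false
    forcer-adj    : ∀ {t} → t < duration → Adj G (forcer t) (forced t)
    forcer-rule   : ∀ {t} → t < duration → ∀ {y} → Adj G (forcer t) y → y ≢ forced t → black t y ≡ true
    black-step    : ∀ {t} → t < duration → ∀ x → black (suc t) x ≡ black t x ∨ does (x Fin.≟ forced t)
    all-black     : ∀ x → black duration x ≡ true

module ForcingRunProperties {G : Graph n} {k} (run : ForcingRun G k) where

  open ForcingRun run

  black-grows : ∀ {t} → t < duration → black t ⊆ᵇ black (suc t)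
  black-grows t<m x x∈B rewrite black-step t<m x | x∈B = refl

  forced-black : ∀ {t} → t < duration → black (suc t) (forced t) ≡ true
  forced-black {t} t<m rewrite black-step t<m (forced t) = ∨-≟-inserted _ (forced t)

  black-step⁻ : ∀ {t} → t < duration → ∀ {x} → black (suc t) x ≡ true → black t x ≡ true ⊎ x ≡ forced t
  black-step⁻ {t} t<m {x} x∈B rewrite black-step t<m x = ∨-≟⁻ (black t x) x (forced t) x∈B

  black-mono : ∀ {s t} → s ≤ t → t ≤ duration → black s ⊆ᵇ black t
  black-mono = ⊆ᵇ-stepwise-mono black black-grows

  forced-∈-active : ∀ {t} → t < duration → forced t ∈ active (suc t)
  forced-∈-active {t} t<m rewrite active-step t<m = ∈-insert (before t)

  forcer-∈-active : ∀ {t} → t < duration → forcer t ∈ active t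
  forcer-∈-active {t} t<m rewrite active-split t<m = ∈-insert (before t)

  ∈-active-step⁻ : ∀ {t} → t < duration → ∀ {x} → x ∈ active (suc t) → x ≡ forced t ⊎ x ∈ active t
  ∈-active-step⁻ {t} t<m x∈A rewrite active-split t<m | active-step t<m
    with ∈-++-∷⁻ (before t) x∈A
  ... | inj₁ x≡g      = inj₁ x≡g
  ... | inj₂ x∈others = inj₂ (∈-++-∷⁺ (before t) x∈others)

  ∈-active-step⁺ : ∀ {t} → t < duration → ∀ {x} → x ∈ active t → x ≡ forcer t ⊎ x ∈ active (suc t)
  ∈-active-step⁺ {t} t<m x∈A rewrite active-split t<m | active-step t<m
    with ∈-++-∷⁻ (before t) x∈A
  ... | inj₁ x≡w      = inj₁ x≡w
  ... | inj₂ x∈others = inj₂ (∈-++-∷⁺ (before t) x∈others)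

  active⇒black : ∀ {t} → t ≤ duration → ∀ {x} → x ∈ active t → black t x ≡ true
  active⇒black {zero}  _    x∈A = active₀⇒black x∈A
  active⇒black {suc t} t<m  x∈A with ∈-active-step⁻ t<m x∈A
  ... | inj₁ refl = forced-black t<m
  ... | inj₂ x∈A′ = black-grows t<m _ (active⇒black (<⇒≤ t<m) x∈A′)

  passive⇒was-forcer : ∀ {t} → t ≤ duration → ∀ {x} → black t x ≡ true → x ∉ active t →
                       ∃ λ s → s < t × forcer s ≡ x
  passive⇒was-forcer {zero}  _   x∈B x∉A = contradiction (black₀⇒active x∈B) x∉A
  passive⇒was-forcer {suc t} t<m {x} x∈B x∉A with black-step⁻ t<m x∈B
  ... | inj₂ refl = contradiction (forced-∈-active t<m) x∉A
  ... | inj₁ x∈B′ with x Fin.≟ forcer t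
  ...   | yes x≡w = t , ≤-refl , sym x≡w
  ...   | no x≢w with passive⇒was-forcer (<⇒≤ t<m) x∈B′ (x∉A′ ∘ ∈-active-step⁺ t<m)
    where
    x∉A′ : ¬ (x ≡ forcer t ⊎ x ∈ active (suc t))
    x∉A′ (inj₁ x≡w) = x≢w x≡w
    x∉A′ (inj₂ x∈A) = x∉A x∈A
  ...     | s , s<t , w≡x = s , m≤n⇒m≤1+n s<t , w≡x

  passive⇒closed : ∀ {t} → t ≤ duration → ∀ {x y} → black t x ≡ true → x ∉ active t → Adj G x y →
                   black t y ≡ true
  passive⇒closed t≤m {x} {y} x∈B x∉A x~y with passive⇒was-forcer t≤m x∈B x∉A
  ... | s , s<t , refl = black-mono s<t t≤m y y∈B[1+s]
    where
    s<m = <-≤-trans s<t t≤m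
    y∈B[1+s] : black (suc s) y ≡ true
    y∈B[1+s] with y Fin.≟ forced s
    ... | yes refl = forced-black s<m
    ... | no y≢g   = black-grows s<m y (forcer-rule s<m x~y y≢g)

-- a and b count chain ends on the two sides, e the black edges of F.
saturation-clash : ∀ a b e → a + b ≤ 3 → e ≤ 2 → 3 ≤ a + e → 3 ≤ b + e → e ≤ 1 ⊎ b ≡ 3 → ⊥
saturation-clash a b e a+b≤3 _ 3≤a+e 3≤b+e (inj₁ e≤1) =
  contradiction (≤-trans (+-mono-≤ (2≤ 3≤a+e) (2≤ 3≤b+e)) a+b≤3) λ { (s≤s (s≤s (s≤s ()))) }
  where
  2≤ : ∀ {c} → 3 ≤ c + e → 2 ≤ c
  2≤ {c} 3≤c+e = ≤-pred (≤-trans 3≤c+e (≤-trans (+-monoʳ-≤ c e≤1) (≤-reflexive (+-comm c 1))))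
saturation-clash a b e a+3≤3 e≤2 3≤a+e _ (inj₂ refl) =
  contradiction (≤-trans 3≤a+e (≤-trans (+-monoˡ-≤ e (+-cancelʳ-≤ 3 a 0 a+3≤3)) e≤2)) λ { (s≤s (s≤s ())) }

module CutArgument {G : Graph n} (δ≥3 : MinDegreeAtLeast 3 G) (side : Fin n → Bool)
  (F : List (Fin n × Fin n)) (|F|≤2 : length F ≤ 2)
  (cut : ∀ {x y} → Adj G x y → side x ≢ side y → (x , y) ∈ F ⊎ (y , x) ∈ F)
  (run : ForcingRun G 3) where

  open ForcingRun run
  open ForcingRunProperties run
  open DecMembership (Fin._≟_ {n}) using (_∈?_)

  count : Bool → List (Fin n) → ℕ
  count X = length ∘ filter (λ y → side y Bool.≟ X)

  BothBlack : ℕ → Fin n × Fin n → Set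
  BothBlack t (a , b) = black t a ≡ true × black t b ≡ true

  bothBlack? : ∀ t → Decidable (BothBlack t)
  bothBlack? t (a , b) = (black t a Bool.≟ true) ×-dec (black t b Bool.≟ true)

  blackCut : ℕ → ℕ
  blackCut t = length (filter (bothBlack? t) F)

  potential : Bool → ℕ → ℕ
  potential X t = count X (active t) + blackCut t

  Crosses : ℕ → Fin n → Fin n × Fin n → Set
  Crosses t x (a , b) = BothBlack t (a , b) × (a ≡ x × side b ≢ side x ⊎ b ≡ x × side a ≢ side x)

  crosses? : ∀ t x → Decidable (Crosses t x)
  crosses? t x (a , b) = bothBlack? t (a , b) ×-dec
    ((a Fin.≟ x ×-dec ¬? (side b Bool.≟ side x)) ⊎-dec (b Fin.≟ x ×-dec ¬? (side a Bool.≟ side x)))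

  opposite : Fin n → Fin n × Fin n → Fin n
  opposite x (a , b) = if does (a Fin.≟ x) then b else a

  crossNeighbours : ℕ → Fin n → List (Fin n)
  crossNeighbours t x = map (opposite x) (filter (crosses? t x) F)

  blackCut≤2 : ∀ t → blackCut t ≤ 2
  blackCut≤2 t = ≤-trans (length-filter (bothBlack? t) F) |F|≤2

  blackCut-grows : ∀ {t} → t < duration → blackCut t ≤ blackCut (suc t)
  blackCut-grows t<m = length-filter-mono (bothBlack? _) (bothBlack? _)
    (λ (a∈B , b∈B) → black-grows t<m _ a∈B , black-grows t<m _ b∈B) F

  Joins : Fin n × Fin n → Fin n → Fin n → Set
  Joins e x y = e ≡ (x , y) ⊎ e ≡ (y , x)

  joins-white⇒¬BothBlack : ∀ {t e x y} → Joins e x y → black t y ≡ false → ¬ BothBlack t e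
  joins-white⇒¬BothBlack (inj₁ refl) y∉B (_ , y∈B) = Bool.not-¬ y∉B y∈B
  joins-white⇒¬BothBlack (inj₂ refl) y∉B (y∈B , _) = Bool.not-¬ y∉B y∈B

  joins-black⇒BothBlack : ∀ {t e x y} → Joins e x y → black t x ≡ true → black t y ≡ true → BothBlack t e
  joins-black⇒BothBlack (inj₁ refl) x∈B y∈B = x∈B , y∈B
  joins-black⇒BothBlack (inj₂ refl) x∈B y∈B = y∈B , x∈B

  cut-edge : ∀ {x y} → Adj G x y → side x ≢ side y → ∃ λ e → e ∈ F × Joins e x y
  cut-edge x~y sx≢sy with cut x~y sx≢sy
  ... | inj₁ xy∈F = _ , xy∈F , inj₁ refl
  ... | inj₂ yx∈F = _ , yx∈F , inj₂ refl

  white-cut-end⇒blackCut≤1 : ∀ {t x y} → Adj G x y → side x ≢ side y → black t y ≡ false → blackCut t ≤ 1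
  white-cut-end⇒blackCut≤1 {t} x~y sx≢sy y∉B with cut-edge x~y sx≢sy
  ... | e , e∈F , joins = ≤-pred (≤-trans (filter-notAll (bothBlack? t) F
                            (Any.map (λ { refl → joins-white⇒¬BothBlack joins y∉B }) e∈F)) |F|≤2)

  forcing-across-cut : ∀ {t} → t < duration → side (forcer t) ≢ side (forced t) →
                       blackCut t < blackCut (suc t)
  forcing-across-cut {t} t<m sw≢sg with cut-edge (forcer-adj t<m) sw≢sg
  ... | e , e∈F , joins = length-filter-mono-< (bothBlack? t) (bothBlack? (suc t))
        (λ (a∈B , b∈B) → black-grows t<m _ a∈B , black-grows t<m _ b∈B)
        (Any.map (λ { refl → joins-black⇒BothBlack joins w∈B′ (forced-black t<m)
                           , joins-white⇒¬BothBlack joins (forced-white t<m) }) e∈F)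
    where
    w∈B′ = black-grows t<m _ (active⇒black (<⇒≤ t<m) (forcer-∈-active t<m))

  opposite-fst : ∀ x y → opposite x (x , y) ≡ y
  opposite-fst x y rewrite ≡-≟-identity Fin._≟_ (refl {x = x}) = refl

  opposite-snd : ∀ {x y} → y ≢ x → opposite x (y , x) ≡ y
  opposite-snd {x} {y} y≢x with y Fin.≟ x
  ... | yes y≡x = contradiction y≡x y≢x
  ... | no _    = refl

  crossNeighbours≤blackCut : ∀ t x → length (crossNeighbours t x) ≤ blackCut t
  crossNeighbours≤blackCut t x = ≤-trans (≤-reflexive (length-map (opposite x) (filter (crosses? t x) F)))
    (length-filter-mono (crosses? t x) (bothBlack? t) proj₁ F)

  crossNeighbours-disjoint : ∀ t {x r} → x ≢ r → side x ≡ side r →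
                             length (crossNeighbours t x) + length (crossNeighbours t r) ≤ 2
  crossNeighbours-disjoint t {x} {r} x≢r sx≡sr
    rewrite length-map (opposite x) (filter (crosses? t x) F) | length-map (opposite r) (filter (crosses? t r) F)
    = ≤-trans (length-filter-disjoint (crosses? t x) (crosses? t r) not-both F) |F|≤2
    where
    not-both : ∀ {e} → Crosses t x e → Crosses t r e → ⊥
    not-both (_ , inj₁ (refl , _))     (_ , inj₁ (refl , _)) = x≢r refl
    not-both (_ , inj₁ (refl , sb≢sx)) (_ , inj₂ (refl , _)) = sb≢sx (sym sx≡sr)
    not-both (_ , inj₂ (refl , sa≢sx)) (_ , inj₁ (refl , _)) = sa≢sx (sym sx≡sr)
    not-both (_ , inj₂ (refl , _))     (_ , inj₂ (refl , _)) = x≢r refl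

  cross-neighbour : ∀ {t x y} → black t x ≡ true → black t y ≡ true → Adj G x y → side x ≢ side y →
                    y ∈ crossNeighbours t x
  cross-neighbour {t} {x} {y} x∈B y∈B x~y sx≢sy with cut x~y sx≢sy
  ... | inj₁ xy∈F = subst (_∈ crossNeighbours t x) (opposite-fst x y)
    (∈-map⁺ (opposite x) (∈-filter⁺ (crosses? t x) xy∈F ((x∈B , y∈B) , inj₁ (refl , sx≢sy ∘ sym))))
  ... | inj₂ yx∈F = subst (_∈ crossNeighbours t x) (opposite-snd (Adj-irrefl G x~y ∘ sym))
    (∈-map⁺ (opposite x) (∈-filter⁺ (crosses? t x) yx∈F ((y∈B , x∈B) , inj₂ (refl , sx≢sy ∘ sym))))

  neighbour-cover⇒3≤length : ∀ x ys → (∀ {y} → Adj G x y → y ∈ ys) → 3 ≤ length ys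
  neighbour-cover⇒3≤length x ys cover = ≤-trans (δ≥3 x) (degree≤length G x ys cover)

  neighbour-cover⇒3≤length+cross : ∀ t x ys → black t x ≡ true →
    (∀ {y} → Adj G x y → y ∈ ys ⊎ (black t y ≡ true × side x ≢ side y)) →
    3 ≤ length ys + length (crossNeighbours t x)
  neighbour-cover⇒3≤length+cross t x ys x∈B cover =
    subst (3 ≤_) (length-++ ys)
      (neighbour-cover⇒3≤length x (ys ++ crossNeighbours t x) λ x~y → case x~y (cover x~y))
    where
    case : ∀ {y} → Adj G x y → y ∈ ys ⊎ (black t y ≡ true × side x ≢ side y) → y ∈ ys ++ crossNeighbours t x
    case _   (inj₁ y∈ys)         = ∈-++⁺ˡ y∈ys
    case x~y (inj₂ (y∈B , sx≢sy)) = ∈-++⁺ʳ ys (cross-neighbour x∈B y∈B x~y sx≢sy)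

  count-middle : ∀ X xs w ys → count X (xs ++ w ∷ ys) ≡ count X (w ∷ []) + count X (xs ++ ys)
  count-middle X = length-filter-middle (λ y → side y Bool.≟ X)

  count-split-on : ∀ X xs ys {w} → side w ≡ X → count X (xs ++ w ∷ ys) ≡ suc (count X (xs ++ ys))
  count-split-on X xs ys {w} sw≡X = trans (count-middle X xs w ys)
    (cong (λ c → length c + count X (xs ++ ys)) (filter-accept (λ y → side y Bool.≟ X) sw≡X))

  count-active≤3 : ∀ X t → count X (active t) ≤ 3
  count-active≤3 X t = subst (count X (active t) ≤_) (active-length t) (length-filter _ (active t))

  count-both-sides : ∀ X t → count X (active t) + count (not X) (active t) ≤ 3
  count-both-sides X t = subst (count X (active t) + count (not X) (active t) ≤_) (active-length t)
    (length-filter-disjoint (λ y → side y Bool.≟ X) (λ y → side y Bool.≟ not X) Bool.not-¬ (active t))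

  forcer-term≤forced-term : ∀ X {t} → t < duration →
    count X (forcer t ∷ []) + blackCut t ≤ count X (forced t ∷ []) + blackCut (suc t)
  forcer-term≤forced-term X {t} t<m with side (forcer t) Bool.≟ X | side (forced t) Bool.≟ X
  ... | no sw≢X | _ = ≤-trans (blackCut-grows t<m) (m≤n+m _ _)
  ... | yes sw≡X | yes sg≡X = s≤s (blackCut-grows t<m)
  ... | yes sw≡X | no sg≢X =
    forcing-across-cut t<m λ sw≡sg → sg≢X (trans (sym sw≡sg) sw≡X)

  potential-grows : ∀ X {t} → t < duration → potential X t ≤ potential X (suc t)
  potential-grows X {t} t<m = begin
    count X (active t) + blackCut t
      ≡⟨ cong (λ l → count X l + blackCut t) (active-split t<m) ⟩
    count X (before t ++ forcer t ∷ after t) + blackCut t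
      ≡⟨ cong (_+ blackCut t) (count-middle X (before t) (forcer t) (after t)) ⟩
    count X (forcer t ∷ []) + rest + blackCut t
      ≡⟨ move-rest _ (blackCut t) ⟩
    rest + (count X (forcer t ∷ []) + blackCut t)
      ≤⟨ +-monoʳ-≤ rest (forcer-term≤forced-term X t<m) ⟩
    rest + (count X (forced t ∷ []) + blackCut (suc t))
      ≡⟨ move-rest _ (blackCut (suc t)) ⟨
    count X (forced t ∷ []) + rest + blackCut (suc t)
      ≡⟨ cong (_+ blackCut (suc t)) (count-middle X (before t) (forced t) (after t)) ⟨
    count X (before t ++ forced t ∷ after t) + blackCut (suc t)
      ≡⟨ cong (λ l → count X l + blackCut (suc t)) (active-step t<m) ⟨
    count X (active (suc t)) + blackCut (suc t) ∎
    where
    open ≤-Reasoning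
    rest = count X (before t ++ after t)
    move-rest : ∀ a e → a + rest + e ≡ rest + (a + e)
    move-rest a e = trans (cong (_+ e) (+-comm a rest)) (+-assoc rest a e)

  potential-mono : ∀ X {s t} → s ≤ t → t ≤ duration → potential X s ≤ potential X t
  potential-mono X = stepwise-mono _≤_ ≤-refl ≤-trans (potential X) (potential-grows X)

  Saturated : Bool → ℕ → Set
  Saturated X τ = 3 ≤ potential X τ × (blackCut τ ≤ 1 ⊎ count X (active τ) ≡ 3)

  saturated-before-opposite : ∀ X {τ τ′} → τ ≤ τ′ → τ′ ≤ duration → 3 ≤ potential X τ →
                              ¬ Saturated (not X) τ′
  saturated-before-opposite X {τ} {τ′} τ≤τ′ τ′≤m 3≤Φ (3≤Φ′ , small) =
    saturation-clash (count X (active τ′)) (count (not X) (active τ′)) (blackCut τ′)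
      (count-both-sides X τ′) (blackCut≤2 τ′) (≤-trans 3≤Φ (potential-mono X τ≤τ′ τ′≤m))
      3≤Φ′ small

  opposite-sides-not-both-saturated : ∀ X {τ τ′} → τ ≤ duration → τ′ ≤ duration →
                                      Saturated X τ → ¬ Saturated (not X) τ′
  opposite-sides-not-both-saturated X {τ} {τ′} τ≤m τ′≤m satX sat¬X with ≤-total τ τ′
  ... | inj₁ τ≤τ′ = saturated-before-opposite X τ≤τ′ τ′≤m (proj₁ satX) sat¬X
  ... | inj₂ τ′≤τ = saturated-before-opposite (not X) τ′≤τ τ≤m (proj₁ sat¬X)
                      (subst (λ Y → Saturated Y τ) (sym (Bool.not-involutive X)) satX)

  Thin : Bool → Set
  Thin X = ∀ {t} → t ≤ duration → count X (active t) ≤ 2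

  never-full⇒thin : ∀ {X} → (∀ {t} → t ≤ duration → count X (active t) ≢ 3) → Thin X
  never-full⇒thin {X} ¬full {t} t≤m = ≤-pred (≤∧≢⇒< (count-active≤3 X t) (¬full t≤m))

  unforced-side⇒active : ∀ {X t y} → t ≤ duration → (∀ {s} → s < t → side (forcer s) ≢ X) →
                         black t y ≡ true → side y ≡ X → y ∈ active t
  unforced-side⇒active {t = t} {y} t≤m unforced y∈B sy≡X with y ∈? active t
  ... | yes y∈A = y∈A
  ... | no y∉A with passive⇒was-forcer t≤m y∈B y∉A
  ...   | s , s<t , refl = contradiction sy≡X (unforced s<t)

  ∈-active-other : ∀ {t y} → t < duration → y ∈ active t → y ≢ forcer t → y ∈ before t ++ after t
  ∈-active-other {t} t<m y∈A y≢w with ∈-++-∷⁻ (before t) (subst (_ ∈_) (active-split t<m) y∈A)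
  ... | inj₁ y≡w = contradiction y≡w y≢w
  ... | inj₂ y∈others = y∈others

  final-cover : ∀ x ys → (∀ {y} → Adj G x y → side x ≡ side y → y ∈ ys) →
                3 ≤ length ys + length (crossNeighbours duration x)
  final-cover x ys same-side = neighbour-cover⇒3≤length+cross duration x ys (all-black x) cover
    where
    cover : ∀ {y} → Adj G x y → y ∈ ys ⊎ (black duration y ≡ true × side x ≢ side y)
    cover {y} x~y with side x Bool.≟ side y
    ... | yes sx≡sy = inj₁ (same-side x~y sx≡sy)
    ... | no sx≢sy  = inj₂ (all-black y , sx≢sy)

  same-side-covered : ∀ {X x₀ os} → side x₀ ≡ X → (∀ {y} → side y ≡ X → y ≢ x₀ → y ∈ os) →
                      ∀ {y} → Adj G x₀ y → side x₀ ≡ side y → y ∈ os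
  same-side-covered sx₀≡X complete x₀~y sx₀≡sy =
    complete (trans (sym sx₀≡sy) sx₀≡X) (Adj-irrefl G x₀~y ∘ sym)

  sparse-side⇒⊥ : ∀ {X x₀} os → side x₀ ≡ X → length os ≤ 1 →
                  (∀ {y} → side y ≡ X → y ≢ x₀ → y ∈ os) →
                  (∀ {y} → y ∈ os → side y ≡ X × y ≢ x₀) → ⊥
  sparse-side⇒⊥ {x₀ = x₀} [] sx₀≡X _ complete _ =
    contradiction (≤-trans (final-cover x₀ [] (same-side-covered sx₀≡X complete))
                           (≤-trans (crossNeighbours≤blackCut duration x₀) (blackCut≤2 duration)))
                  λ { (s≤s (s≤s ())) }
  sparse-side⇒⊥ {x₀ = x₀} (r ∷ []) sx₀≡X _ complete sound with sr≡X , r≢x₀ ← sound (here refl) =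
    contradiction (≤-trans (+-mono-≤ (final-cover x₀ (r ∷ []) (same-side-covered sx₀≡X complete))
                                     (final-cover r (x₀ ∷ []) r-cover))
                  (≤-trans (≤-reflexive (cong suc (+-suc _ _)))
                  (s≤s (s≤s (crossNeighbours-disjoint duration (r≢x₀ ∘ sym) (trans sx₀≡X (sym sr≡X)))))))
                  λ { (s≤s (s≤s (s≤s (s≤s ())))) }
    where
    r-cover : ∀ {y} → Adj G r y → side r ≡ side y → y ∈ x₀ ∷ []
    r-cover {y} r~y sr≡sy with y Fin.≟ x₀
    ... | yes y≡x₀ = here y≡x₀
    ... | no y≢x₀ with complete (trans (sym sr≡sy) sr≡X) y≢x₀
    ...   | here y≡r = contradiction (sym y≡r) (Adj-irrefl G r~y)
  sparse-side⇒⊥ (_ ∷ _ ∷ _) _ (s≤s ()) _ _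

  -- A thin side none of whose vertices ever forces consists of at most two chain ends,
  -- and these cannot reach degree 3 using at most two edges of F.
  never-forcing-side⇒⊥ : ∀ {X x₀} → Thin X → (∀ {s} → s < duration → side (forcer s) ≢ X) →
                         side x₀ ≡ X → ⊥
  never-forcing-side⇒⊥ {X} {x₀} thin never sx₀≡X =
    sparse-side⇒⊥ others sx₀≡X |others|≤1
      (λ sy≡X y≢x₀ → ∈-filter⁺ others? (on-side⇒active sy≡X) (sy≡X , y≢x₀))
      (λ y∈others → proj₂ (∈-filter⁻ others? {xs = active duration} y∈others))
    where
    on-side⇒active : ∀ {y} → side y ≡ X → y ∈ active duration
    on-side⇒active {y} = unforced-side⇒active ≤-refl never (all-black y)
    others? : Decidable λ y → side y ≡ X × y ≢ x₀
    others? y = (side y Bool.≟ X) ×-dec ¬? (y Fin.≟ x₀)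
    others = filter others? (active duration)
    |others|≤1 : length others ≤ 1
    |others|≤1 = ≤-pred (≤-trans (length-filter-mono-< others? (λ y → side y Bool.≟ X) proj₁ x₀-excluded)
                                 (thin ≤-refl))
      where
      x₀-excluded = Any.map (λ { refl → sx₀≡X , λ (_ , x₀≢x₀) → x₀≢x₀ refl }) (on-side⇒active sx₀≡X)

  first-force-potential : ∀ {X f} → f < duration → side (forcer f) ≡ X →
                          (∀ {s} → s < f → side (forcer s) ≢ X) → 3 ≤ potential X f
  first-force-potential {X} {f} f<m sw≡X earlier = begin
    3
      ≤⟨ neighbour-cover⇒3≤length+cross f w (forced f ∷ same) w∈B cover ⟩
    suc (count X others) + length (crossNeighbours f w)
      ≤⟨ +-monoʳ-≤ (suc _) (crossNeighbours≤blackCut f w) ⟩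
    suc (count X others) + blackCut f
      ≡⟨ cong (_+ blackCut f) (count-split-on X (before f) (after f) sw≡X) ⟨
    count X (before f ++ w ∷ after f) + blackCut f
      ≡⟨ cong (λ l → count X l + blackCut f) (active-split f<m) ⟨
    potential X f ∎
    where
    open ≤-Reasoning
    w = forcer f
    w∈B = active⇒black (<⇒≤ f<m) (forcer-∈-active f<m)
    others = before f ++ after f
    same = filter (λ y → side y Bool.≟ X) others
    cover : ∀ {y} → Adj G w y → y ∈ forced f ∷ same ⊎ (black f y ≡ true × side w ≢ side y)
    cover {y} w~y with y Fin.≟ forced f
    ... | yes refl = inj₁ (here refl)
    ... | no y≢g with side w Bool.≟ side y
    ...   | no sw≢sy  = inj₂ (forcer-rule f<m w~y y≢g , sw≢sy)
    ...   | yes sw≡sy = inj₁ (there (∈-filter⁺ _ (∈-active-other f<m y∈A (Adj-irrefl G w~y ∘ sym)) sy≡X))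
      where
      sy≡X = trans (sym sw≡sy) sw≡X
      y∈A = unforced-side⇒active (<⇒≤ f<m) earlier (forcer-rule f<m w~y y≢g) sy≡X

  AllBlackOn : Bool → ℕ → Set
  AllBlackOn X t = ∀ x → side x ≡ X → black t x ≡ true

  allBlackOn? : ∀ X t → Dec (AllBlackOn X t)
  allBlackOn? X t = Fin.all? λ x → (side x Bool.≟ X) →-dec (black t x Bool.≟ true)

  completing-force-on-side : ∀ {X l} → l < duration → ¬ AllBlackOn X l → AllBlackOn X (suc l) →
                             side (forced l) ≡ X
  completing-force-on-side {X} {l} l<m ¬all all′ with side (forced l) Bool.≟ X
  ... | yes sL≡X = sL≡X
  ... | no sL≢X  = contradiction all ¬all
    where
    all : AllBlackOn X l
    all x sx≡X with black-step⁻ l<m (all′ x sx≡X)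
    ... | inj₁ x∈B  = x∈B
    ... | inj₂ refl = contradiction sx≡X sL≢X

  -- The vertex L forced last on a thin side X: its X-neighbours other than its forcer
  -- are active, so if it had no neighbour across the cut its degree would be at most 2.
  completing-force-crosses : ∀ {X l} → Thin X → l < duration → side (forced l) ≡ X → AllBlackOn X (suc l) →
                             ∃ λ y → Adj G (forced l) y × side y ≢ X
  completing-force-crosses {X} {l} thin l<m sL≡X all′
    with Fin.any? (λ y → (adj G (forced l) y Bool.≟ true) ×-dec ¬? (side y Bool.≟ X))
  ... | yes crossing-neighbour = crossing-neighbour
  ... | no none = contradiction (≤-trans (neighbour-cover⇒3≤length L (forcer l ∷ same) cover) ≤2)
                                λ { (s≤s (s≤s ())) }
    where
    L = forced l
    same = filter (λ y → side y Bool.≟ X) (before l ++ after l)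
    ≤2 : suc (count X (before l ++ after l)) ≤ 2
    ≤2 = subst (_≤ 2) (trans (cong (count X) (active-step l<m)) (count-split-on X (before l) (after l) sL≡X))
               (thin l<m)
    same-side : ∀ {y} → Adj G L y → side y ≡ X
    same-side {y} L~y = decidable-stable (side y Bool.≟ X) λ sy≢X → none (y , L~y , sy≢X)
    cover : ∀ {y} → Adj G L y → y ∈ forcer l ∷ same
    cover {y} L~y with y Fin.≟ forcer l | black-step⁻ l<m (all′ y (same-side L~y))
    ... | yes y≡w | _         = here y≡w
    ... | no _    | inj₂ refl = contradiction refl (Adj-irrefl G L~y)
    ... | no y≢w  | inj₁ y∈B with y ∈? active l
    ...   | yes y∈A = there (∈-filter⁺ _ (∈-active-other l<m y∈A y≢w) (same-side L~y))
    ...   | no y∉A  = contradiction (passive⇒closed (<⇒≤ l<m) y∈B y∉A (Adj-sym G L~y))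
                                    (Bool.not-¬ (forced-white l<m))

  -- Either the first force from X crosses F, or the vertex of X to turn black last is
  -- still white at time f and has a neighbour across F.
  first-force-blackCut : ∀ {X f} → Thin X → f < duration → side (forcer f) ≡ X → blackCut f ≤ 1
  first-force-blackCut {X} {f} thin f<m sw≡X with side (forced f) Bool.≟ X
  ... | no sg≢X = white-cut-end⇒blackCut≤1 (forcer-adj f<m) (λ sw≡sg → sg≢X (trans (sym sw≡sg) sw≡X))
                    (forced-white f<m)
  ... | yes sg≡X
    with l , f≤l , l<m , ¬all , all′ ← crossing (allBlackOn? X) (<⇒≤ f<m)
                                         (λ all → Bool.not-¬ (forced-white f<m) (all _ sg≡X))
                                         (λ x _ → all-black x)
    with sL≡X ← completing-force-on-side l<m ¬all all′
    with y , L~y , sy≢X ← completing-force-crosses thin l<m sL≡X all′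
    = white-cut-end⇒blackCut≤1 (Adj-sym G L~y) (λ sy≡sL → sy≢X (trans sy≡sL sL≡X)) L∉B[f]
    where
    L∉B[f] : black f (forced l) ≡ false
    L∉B[f] = Bool.¬-not λ L∈B[f] → Bool.not-¬ (forced-white l<m) (black-mono f≤l (<⇒≤ l<m) _ L∈B[f])

  thin-side-saturates : ∀ {X x₀} → Thin X → side x₀ ≡ X → ∃ λ τ → τ ≤ duration × Saturated X τ
  thin-side-saturates {X} thin sx₀≡X with least-below (λ s → side (forcer s) Bool.≟ X) duration
  ... | inj₂ never = ⊥-elim (never-forcing-side⇒⊥ thin never sx₀≡X)
  ... | inj₁ (f , f<m , sw≡X , earlier) =
    f , <⇒≤ f<m , first-force-potential f<m sw≡X earlier , inj₁ (first-force-blackCut thin f<m sw≡X)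

  saturates : ∀ {X x₀} → side x₀ ≡ X → ∃ λ τ → τ ≤ duration × Saturated X τ
  saturates {X} sx₀≡X with anyUpTo? (λ t → count X (active t) ≟ 3) (suc duration)
  ... | yes (τ , τ<1+m , full) =
    τ , ≤-pred τ<1+m , subst (λ c → 3 ≤ c + blackCut τ) (sym full) (m≤m+n 3 _) , inj₂ full
  ... | no ¬full = thin-side-saturates (never-full⇒thin λ t≤m full → ¬full (_ , s≤s t≤m , full)) sx₀≡X

  both-sides-inhabited⇒⊥ : ∀ {x y} → side x ≡ true → side y ≡ false → ⊥
  both-sides-inhabited⇒⊥ sx≡true sy≡false
    with τ , τ≤m , sat ← saturates sx≡true
       | τ′ , τ′≤m , sat′ ← saturates sy≡false
    = opposite-sides-not-both-saturated true τ≤m τ′≤m sat sat′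

module Construction {G : Graph n} {Z : Subset n} (zfs : IsZeroForcingSet G Z) (junk : Fin n) where

  open DecMembership (Fin._≟_ {n}) using (_∈?_)

  record State : Set where
    field
      black  : Fin n → Bool
      active : List (Fin n)

  open State

  record Force (s : State) : Set where
    field
      forcer forced : Fin n
      before after  : List (Fin n)
      split         : active s ≡ before ++ forcer ∷ after
      forced-white  : black s forced ≡ false
      adjacent      : Adj G forcer forced
      rule          : ∀ {y} → Adj G forcer y → y ≢ forced → black s y ≡ true

  force-from : ∀ {s w g} → w ∈ active s → black s g ≡ false → Adj G w g →
               (∀ {y} → Adj G w y → y ≢ g → black s y ≡ true) → Force s
  force-from w∈A g∉B w~g rule with xs , ys , split ← ∈-∃++ w∈A =
    record { before = xs ; after = ys ; split = split ; forced-white = g∉B ; adjacent = w~g ; rule = rule }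

  force? : ∀ s → Dec (Force s)
  force? s with Fin.any? (λ w → (w ∈? active s) ×-dec Fin.any? λ g → (black s g Bool.≟ false) ×-dec
                  (adj G w g Bool.≟ true) ×-dec Fin.all? λ y →
                  (adj G w y Bool.≟ true) →-dec ¬? (y Fin.≟ g) →-dec (black s y Bool.≟ true))
  ... | yes (w , w∈A , g , g∉B , w~g , rule) = yes (force-from w∈A g∉B w~g λ w~y y≢g → rule _ w~y y≢g)
  ... | no none = no λ f → let open Force f in
    none (forcer , subst (forcer ∈_) (sym split) (∈-insert before) , forced , forced-white , adjacent ,
          λ _ w~y y≢g → rule w~y y≢g)

  apply : (s : State) → Force s → State
  apply s f = record { black = λ x → black s x ∨ does (x Fin.≟ forced) ; active = before ++ forced ∷ after }
    where open Force f

  step : (s : State) → Dec (Force s) → State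
  step s (yes f) = apply s f
  step s (no _)  = s

  state : ℕ → State
  state zero    = record { black = λ x → does (x Subset.∈? Z) ; active = elements Z }
  state (suc t) = step (state t) (force? (state t))

  Closed : State → Set
  Closed s = ∀ {x y} → black s x ≡ true → x ∉ active s → Adj G x y → black s y ≡ true

  module Applied {s} (f : Force s) where

    open Force f

    grows : black s ⊆ᵇ black (apply s f)
    grows x x∈B rewrite x∈B = refl

    forced-black : black (apply s f) forced ≡ true
    forced-black = ∨-≟-inserted _ forced

    same-length : length (active (apply s f)) ≡ length (active s)
    same-length = begin
      length (before ++ forced ∷ after)       ≡⟨ length-++ before ⟩
      length before + length (forced ∷ after) ≡⟨ length-++ before ⟨
      length (before ++ forcer ∷ after)       ≡⟨ cong length split ⟨
      length (active s)                       ∎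
      where open ≡-Reasoning

    preserves-closed : Closed s → Closed (apply s f)
    preserves-closed closed {x} {y} x∈B′ x∉A′ x~y with ∨-≟⁻ (black s x) x forced x∈B′
    ... | inj₂ refl = contradiction (∈-insert before) x∉A′
    ... | inj₁ x∈B with x Fin.≟ forcer
    ...   | no x≢w = grows y (closed x∈B x∉A x~y)
      where
      x∉A : x ∉ active s
      x∉A x∈A with ∈-++-∷⁻ before (subst (x ∈_) split x∈A)
      ... | inj₁ x≡w      = x≢w x≡w
      ... | inj₂ x∈others = x∉A′ (∈-++-∷⁺ before x∈others)
    ...   | yes refl with y Fin.≟ forced
    ...     | yes refl = Bool.∨-zeroʳ (black s forced)
    ...     | no y≢g   = trans (Bool.∨-identityʳ (black s y)) (rule x~y y≢g)

  black-grows : ∀ t → black (state t) ⊆ᵇ black (state (suc t))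
  black-grows t with force? (state t)
  ... | yes f = Applied.grows f
  ... | no _  = λ _ x∈B → x∈B

  Z⊆black : ∀ t → ∀ {x} → x ∈ₛ Z → black (state t) x ≡ true
  Z⊆black t {x} x∈Z = growing⇒mono (black ∘ state) black-grows {t = t} z≤n x (dec-true (x Subset.∈? Z) x∈Z)

  length-active : ∀ t → length (active (state t)) ≡ ∣ Z ∣
  length-active zero = length-elements Z
  length-active (suc t) with force? (state t)
  ... | yes f = trans (Applied.same-length f) (length-active t)
  ... | no _  = length-active t

  closed : ∀ t → Closed (state t)
  closed zero {x} x∈B x∉A _ with x Subset.∈? Z
  ... | yes x∈Z = contradiction (∈-elements⁺ Z x∈Z) x∉A
  closed (suc t) with force? (state t)
  ... | yes f = Applied.preserves-closed f (closed t)
  ... | no _  = closed t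

  stuck⇒all-black : ∀ t → ¬ Force (state t) → ∀ v → black (state t) v ≡ true
  stuck⇒all-black t stuck v = forced⇒black (zfs v)
    where
    s = state t
    forced⇒black : ∀ {v} → Forced G Z v → black s v ≡ true
    forced⇒black (initial v∈Z) = Z⊆black t v∈Z
    forced⇒black {v} (force {u} forced-u u~v others) with black s v in v∈?B
    ... | true  = refl
    ... | false with u ∈? active s
    ...   | yes u∈A = contradiction (force-from u∈A v∈?B u~v λ u~y y≢v → forced⇒black (others _ u~y y≢v)) stuck
    ...   | no u∉A  = contradiction (closed t (forced⇒black forced-u) u∉A u~v) (Bool.not-¬ v∈?B)

  stable⇒stuck : ∀ t → black (state (suc t)) ⊆ᵇ black (state t) → ¬ Force (state t)
  stable⇒stuck t stable f with force? (state t)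
  ... | yes f′ = Bool.not-¬ (Force.forced-white f′) (stable _ (Applied.forced-black f′))
  ... | no ¬f  = ¬f f

  first-stuck : ∃ λ m → ¬ Force (state m) × (∀ {t} → t < m → ¬ ¬ Force (state t))
  first-stuck with k , _ , stable ← growing⇒stabilises (black ∘ state) black-grows
    with least-below (¬? ∘ force? ∘ state) (suc k)
  ... | inj₁ (m , _ , stuck , unstuck-before) = m , stuck , unstuck-before
  ... | inj₂ never-stuck = contradiction (stable⇒stuck k stable) (never-stuck ≤-refl)

  private
    m = proj₁ first-stuck

    moving : ∀ {t} → t < m → ∃ λ f → force? (state t) ≡ yes f
    moving {t} t<m =
      dec-yes (force? (state t)) (decidable-stable (force? (state t)) (proj₂ (proj₂ first-stuck) t<m))

    -- Junk values once the process has stopped; only times t < m are ever inspected.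
    stepData : ∀ {A : Set} {s} → (Force s → A) → A → Dec (Force s) → A
    stepData component _       (yes f) = component f
    stepData _         default (no _)  = default

    forcerAt forcedAt : ℕ → Fin n
    forcerAt t = stepData Force.forcer junk (force? (state t))
    forcedAt t = stepData Force.forced junk (force? (state t))

    beforeAt afterAt : ℕ → List (Fin n)
    beforeAt t = stepData Force.before [] (force? (state t))
    afterAt  t = stepData Force.after  [] (force? (state t))

  run : ForcingRun G ∣ Z ∣
  run = record
    { duration      = m
    ; black         = black ∘ state
    ; active        = active ∘ state
    ; forcer        = forcerAt
    ; forced        = forcedAt
    ; before        = beforeAt
    ; after         = afterAt
    ; active-length = length-active
    ; black₀⇒active = black₀⇒active
    ; active₀⇒black = λ {x} x∈A → dec-true (x Subset.∈? Z) (∈-elements⁻ Z x∈A)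
    ; active-split  = active-split
    ; active-step   = active-step
    ; forced-white  = forced-white
    ; forcer-adj    = forcer-adj
    ; forcer-rule   = forcer-rule
    ; black-step    = black-step
    ; all-black     = stuck⇒all-black m (proj₁ (proj₂ first-stuck))
    }
    where
    black₀⇒active : ∀ {x} → does (x Subset.∈? Z) ≡ true → x ∈ elements Z
    black₀⇒active {x} _ with x Subset.∈? Z
    ... | yes x∈Z = ∈-elements⁺ Z x∈Z

    active-split : ∀ {t} → t < m → active (state t) ≡ beforeAt t ++ forcerAt t ∷ afterAt t
    active-split {t} t<m with force? (state t) | moving t<m
    ... | _ | f , refl = Force.split f

    active-step : ∀ {t} → t < m → active (state (suc t)) ≡ beforeAt t ++ forcedAt t ∷ afterAt t
    active-step {t} t<m with force? (state t) | moving t<m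
    ... | _ | f , refl = refl

    forced-white : ∀ {t} → t < m → black (state t) (forcedAt t) ≡ false
    forced-white {t} t<m with force? (state t) | moving t<m
    ... | _ | f , refl = Force.forced-white f

    forcer-adj : ∀ {t} → t < m → Adj G (forcerAt t) (forcedAt t)
    forcer-adj {t} t<m with force? (state t) | moving t<m
    ... | _ | f , refl = Force.adjacent f

    forcer-rule : ∀ {t} → t < m → ∀ {y} → Adj G (forcerAt t) y → y ≢ forcedAt t → black (state t) y ≡ true
    forcer-rule {t} t<m with force? (state t) | moving t<m
    ... | _ | f , refl = Force.rule f

    black-step : ∀ {t} → t < m → ∀ x → black (state (suc t)) x ≡ black (state t) x ∨ does (x Fin.≟ forcedAt t)
    black-step {t} t<m x with force? (state t) | moving t<m
    ... | _ | f , refl = refl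

module Component (G : Graph n) (F : List (Fin n × Fin n)) (u : Fin n) where

  open DecMembership (Product.≡-dec (Fin._≟_ {n}) (Fin._≟_ {n})) using (_∈?_)

  R : Fin n → Fin n → Set
  R = AdjMinus G F

  R? : ∀ x y → Dec (R x y)
  R? x y = (adj G x y Bool.≟ true) ×-dec ¬? ((x , y) ∈? F) ×-dec ¬? ((y , x) ∈? F)

  reachable : ℕ → Fin n → Bool
  reachable zero    x = does (x Fin.≟ u)
  reachable (suc k) x = reachable k x ∨ does (Fin.any? λ y → (reachable k y Bool.≟ true) ×-dec R? y x)

  reach-grows : ∀ (k : ℕ) → reachable k ⊆ᵇ reachable (suc k)
  reach-grows k x x∈ rewrite x∈ = refl

  reach-step : ∀ {k : ℕ} {x y} → reachable k x ≡ true → R x y → reachable (suc k) y ≡ true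
  reach-step {k} {x} {y} x∈ x→y
    rewrite dec-true (Fin.any? λ z → (reachable k z Bool.≟ true) ×-dec R? z y) (x , x∈ , x→y) = Bool.∨-zeroʳ _

  reach⇒Star : ∀ k {x} → reachable k x ≡ true → Star R u x
  reach⇒Star zero {x} x∈ with x Fin.≟ u
  ... | yes refl = ε
  reach⇒Star (suc k) {x} x∈ with reachable k x in x∈′
  ... | true = reach⇒Star k x∈′
  ... | false with Fin.any? (λ y → (reachable k y Bool.≟ true) ×-dec R? y x)
  ...   | yes (y , y∈ , y→x) = reach⇒Star k y∈ ◅◅ (y→x ◅ ε)

  private
    stable = growing⇒stabilises reachable reach-grows

  component : Fin n → Bool
  component = reachable (proj₁ stable)

  component-closed : ∀ {x y} → component x ≡ true → R x y → component y ≡ true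
  component-closed x∈ x→y = proj₂ (proj₂ stable) _ (reach-step {proj₁ stable} x∈ x→y)

  u∈component : component u ≡ true
  u∈component = growing⇒mono reachable reach-grows {t = proj₁ stable} z≤n u (dec-true (u Fin.≟ u) refl)

  component⇒Star : ∀ {x} → component x ≡ true → Star R u x
  component⇒Star = reach⇒Star (proj₁ stable)

  unseparated⇒reachable : (∀ {v} → component v ≡ false → ⊥) → ∀ v → Star R u v
  unseparated⇒reachable unseparated v with component v in v∈?C
  ... | true  = component⇒Star v∈?C
  ... | false = ⊥-elim (unseparated v∈?C)

  cut : ∀ {x y} → Adj G x y → component x ≢ component y → (x , y) ∈ F ⊎ (y , x) ∈ F
  cut {x} {y} x~y cx≢cy with (x , y) ∈? F | (y , x) ∈? F
  ... | yes xy∈F | _        = inj₁ xy∈F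
  ... | no _     | yes yx∈F = inj₂ yx∈F
  ... | no xy∉F  | no yx∉F  = contradiction (same-side (x~y , xy∉F , yx∉F) (Adj-sym G x~y , yx∉F , xy∉F)) cx≢cy
    where
    same-side : R x y → R y x → component x ≡ component y
    same-side x→y y→x with component x in cx | component y in cy
    ... | true  | true  = refl
    ... | false | false = refl
    ... | true  | false = contradiction (trans (sym (component-closed cx x→y)) cy) λ ()
    ... | false | true  = contradiction (trans (sym (component-closed cy y→x)) cx) λ ()

-- Connectivity of G is not used: it is the case F = [] of the conclusion.
theorem4 : ∀ {n : ℕ} (G : Graph n) → Connected G → MinDegreeAtLeast 3 G →
    ZeroForcingNumber≡ G 3 → EdgeConnectivityAtLeast 3 G
theorem4 G _ δ≥3 ((Z , zfs , ∣Z∣≡3) , _) F |F|<3 u = unseparated⇒reachable λ v∉C →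
  CutArgument.both-sides-inhabited⇒⊥ δ≥3 component F (≤-pred |F|<3) cut run u∈component v∉C
  where
  open Component G F u
  run = subst (ForcingRun G) ∣Z∣≡3 (Construction.run zfs u)
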